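{- Let the Fine numbers $f_n$ be defined by $f_0=1$, $f_1=0$ and $2(n + 1)f_n = (7n-5)f_{n-1} + 2(2n-1)f_{n-2}$ for $n\geq 2$. The sequence $\{f_n\}_{n\geq 5}$ is ratio log-concave, and the sequence $\{\sqrt[n]{f_n}\}_{n\geq 2}$ is strictly log-concave.
   Context: A sequence $(x_n)_{n\ge m}$ of positive reals is log-concave if $x_n^2\ge x_{n-1}x_{n+1}$ for all $n\ge m+1$, strictly log-concave if the inequality is strict. A sequence $(a_n)_{n\ge m}$ of positive reals is ratio log-concave if $(a_{n+1}/a_n)_{n\ge m}$ is log-concave. -}

module Defs where

open import Data.Nat using (ℕ; _+_; _*_; _∸_; _^_; _≤_; _<_; _≥_)
open import Data.Product using (_×_)
open import Relation.Binary.PropositionalEquality using (_≡_)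

IsFine : (ℕ → ℕ) → Set
IsFine f =
  (f 0 ≡ 1) × (f 1 ≡ 0) ×
  (∀ n → 2 ≤ n →
     2 * (n + 1) * f n ≡ (7 * n ∸ 5) * f (n ∸ 1) + 2 * (2 * n ∸ 1) * f (n ∸ 2))

PositiveFrom : ℕ → (ℕ → ℕ) → Set
PositiveFrom m a = ∀ n → m ≤ n → 0 < a n

-- (a n)_{n ≥ m} is ratio log-concave: a positive and the ratio sequence
-- r n = a (n+1) / a n (n ≥ m) satisfies r n ^ 2 ≥ r (n-1) * r (n+1) for n ≥ m+1.
-- Clearing the (positive) denominators a n ^ 2 * a (n-1) * a (n+1), this is
-- a (n+1) ^ 3 * a (n-1) ≥ a n ^ 3 * a (n+2).
RatioLogConcaveFrom : ℕ → (ℕ → ℕ) → Set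
RatioLogConcaveFrom m a =
  PositiveFrom m a ×
  (∀ n → m + 1 ≤ n → a n ^ 3 * a (n + 2) ≤ a (n + 1) ^ 3 * a (n ∸ 1))

-- (a n ^ (1/n))_{n ≥ m} (m ≥ 1) is strictly log-concave: a positive and for n ≥ m+1
-- (a n ^ (1/n))^2 > a (n-1) ^ (1/(n-1)) * a (n+1) ^ (1/(n+1)).
-- Raising both (positive) sides to the power (n-1) n (n+1), this is
-- a (n-1) ^ (n (n+1)) * a (n+1) ^ ((n-1) n) < a n ^ (2 (n-1) (n+1)).
RootStrictlyLogConcaveFrom : ℕ → (ℕ → ℕ) → Set
RootStrictlyLogConcaveFrom m a =
  PositiveFrom m a ×
  (∀ n → m + 1 ≤ n →
     a (n ∸ 1) ^ (n * (n + 1)) * a (n + 1) ^ ((n ∸ 1) * n)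
       < a n ^ (2 * (n ∸ 1) * (n + 1)))

-- For n ≥ 12 the ratio f n / f (n − 1) lies between 4 − 6/n + 20/(3n²) − 13/(2n³) and
-- 4 − 6/n + 20/(3n²) − 5/n³: through the recurrence, an upper bound on f n / f (n − 1) gives the lower
-- bound on f (n + 1) / f n and vice versa, each step being a polynomial inequality in k = n − 12 with
-- nonnegative coefficients. Eliminating f (n − 1) and f (n + 2) with the recurrence turns ratio
-- log-concavity at n into a quartic inequality in f (n + 1) / f n, which the lower bound settles; the
-- indices 6 ≤ n < 12 are computed. Root log-concavity propagates from n to n + 1: raising
-- f n ³ f (n + 2) ≤ f (n + 1) ³ f (n − 1) to the power n (n + 1) and multiplying by the inequality at n
-- gives the inequality at n + 1, so only 3 ≤ n ≤ 6 need computing.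

module Submission where

open import Data.Bool.Base using (Bool; true; T; _∧_)
open import Data.Bool.Properties using (T-∧)
open import Data.List.Base using (List; []; _∷_)
open import Data.Nat
open import Data.Nat.Properties
open import Algebra.Properties.CommutativeSemigroup *-commutativeSemigroup
  using () renaming (interchange to *-interchange)
open import Data.Nat.Tactic.RingSolver using (solve-∀; solve)
open import Data.Product.Base using (_×_; _,_; proj₁; proj₂)
open import Data.Unit.Base using (tt)
open import Function.Bundles using (Equivalence)
open import Relation.Binary.PropositionalEquality

open import Defs

infixl 6 _⊕_ _+ᶜ_
infixl 7 _⊗_ _*ᶜ_

data Expr : Set where
  var : Expr
  con : ℕ → Expr
  _⊕_ _⊗_ : Expr → Expr → Expr

⟦_⟧ : Expr → ℕ → ℕ
⟦ var ⟧     k = k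
⟦ con c ⟧   k = c
⟦ e ⊕ e′ ⟧ k = ⟦ e ⟧ k + ⟦ e′ ⟧ k
⟦ e ⊗ e′ ⟧ k = ⟦ e ⟧ k * ⟦ e′ ⟧ k

evalᶜ : List ℕ → ℕ → ℕ
evalᶜ []      k = 0
evalᶜ (a ∷ p) k = a + k * evalᶜ p k

_+ᶜ_ : List ℕ → List ℕ → List ℕ
[]      +ᶜ q       = q
(a ∷ p) +ᶜ []      = a ∷ p
(a ∷ p) +ᶜ (b ∷ q) = a + b ∷ p +ᶜ q

scaleᶜ : ℕ → List ℕ → List ℕ
scaleᶜ a []      = []
scaleᶜ a (b ∷ q) = a * b ∷ scaleᶜ a q

_*ᶜ_ : List ℕ → List ℕ → List ℕ
[]      *ᶜ q = []
(a ∷ p) *ᶜ q = scaleᶜ a q +ᶜ (0 ∷ p *ᶜ q)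

coeffs : Expr → List ℕ
coeffs var        = 0 ∷ 1 ∷ []
coeffs (con c)    = c ∷ []
coeffs (e ⊕ e′) = coeffs e +ᶜ coeffs e′
coeffs (e ⊗ e′) = coeffs e *ᶜ coeffs e′

evalᶜ-+ᶜ : ∀ p q k → evalᶜ (p +ᶜ q) k ≡ evalᶜ p k + evalᶜ q k
evalᶜ-+ᶜ []      q       k = refl
evalᶜ-+ᶜ (a ∷ p) []      k = sym (+-identityʳ _)
evalᶜ-+ᶜ (a ∷ p) (b ∷ q) k rewrite evalᶜ-+ᶜ p q k = regroup a b k (evalᶜ p k) (evalᶜ q k)
  where
  regroup : ∀ a b k x y → a + b + k * (x + y) ≡ a + k * x + (b + k * y)
  regroup = solve-∀

evalᶜ-scaleᶜ : ∀ a q k → evalᶜ (scaleᶜ a q) k ≡ a * evalᶜ q k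
evalᶜ-scaleᶜ a []      k = sym (*-zeroʳ a)
evalᶜ-scaleᶜ a (b ∷ q) k rewrite evalᶜ-scaleᶜ a q k = regroup a b k (evalᶜ q k)
  where
  regroup : ∀ a b k x → a * b + k * (a * x) ≡ a * (b + k * x)
  regroup = solve-∀

evalᶜ-*ᶜ : ∀ p q k → evalᶜ (p *ᶜ q) k ≡ evalᶜ p k * evalᶜ q k
evalᶜ-*ᶜ []      q k = refl
evalᶜ-*ᶜ (a ∷ p) q k
  rewrite evalᶜ-+ᶜ (scaleᶜ a q) (0 ∷ p *ᶜ q) k | evalᶜ-scaleᶜ a q k | evalᶜ-*ᶜ p q k =
  regroup a k (evalᶜ p k) (evalᶜ q k)
  where
  regroup : ∀ a k x y → a * y + k * (x * y) ≡ (a + k * x) * y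
  regroup = solve-∀

⟦⟧≡evalᶜ-coeffs : ∀ e k → ⟦ e ⟧ k ≡ evalᶜ (coeffs e) k
⟦⟧≡evalᶜ-coeffs var        k = linear k
  where
  linear : ∀ k → k ≡ k * (1 + k * 0)
  linear = solve-∀
⟦⟧≡evalᶜ-coeffs (con c)    k = constant c k
  where
  constant : ∀ c k → c ≡ c + k * 0
  constant = solve-∀
⟦⟧≡evalᶜ-coeffs (e ⊕ e′) k = begin
  ⟦ e ⟧ k + ⟦ e′ ⟧ k                        ≡⟨ cong₂ _+_ (⟦⟧≡evalᶜ-coeffs e k) (⟦⟧≡evalᶜ-coeffs e′ k) ⟩
  evalᶜ (coeffs e) k + evalᶜ (coeffs e′) k  ≡⟨ evalᶜ-+ᶜ (coeffs e) (coeffs e′) k ⟨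
  evalᶜ (coeffs e +ᶜ coeffs e′) k           ∎
  where open ≡-Reasoning
⟦⟧≡evalᶜ-coeffs (e ⊗ e′) k = begin
  ⟦ e ⟧ k * ⟦ e′ ⟧ k                        ≡⟨ cong₂ _*_ (⟦⟧≡evalᶜ-coeffs e k) (⟦⟧≡evalᶜ-coeffs e′ k) ⟩
  evalᶜ (coeffs e) k * evalᶜ (coeffs e′) k  ≡⟨ evalᶜ-*ᶜ (coeffs e) (coeffs e′) k ⟨
  evalᶜ (coeffs e *ᶜ coeffs e′) k           ∎
  where open ≡-Reasoning

_≤ᶜ_ : List ℕ → List ℕ → Bool
[]      ≤ᶜ q       = true
(a ∷ p) ≤ᶜ []      = (a ≤ᵇ 0) ∧ (p ≤ᶜ [])
(a ∷ p) ≤ᶜ (b ∷ q) = (a ≤ᵇ b) ∧ (p ≤ᶜ q)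

evalᶜ-mono-≤ᶜ : ∀ p q k → T (p ≤ᶜ q) → evalᶜ p k ≤ evalᶜ q k
evalᶜ-mono-≤ᶜ []      q       k _ = z≤n
evalᶜ-mono-≤ᶜ (a ∷ p) []      k h with Equivalence.to T-∧ h
... | a≤0 , p≤[] = subst (a + k * evalᶜ p k ≤_) (*-zeroʳ k)
  (+-mono-≤ (≤ᵇ⇒≤ a 0 a≤0) (*-monoʳ-≤ k (evalᶜ-mono-≤ᶜ p [] k p≤[])))
evalᶜ-mono-≤ᶜ (a ∷ p) (b ∷ q) k h with Equivalence.to T-∧ h
... | a≤b , p≤q = +-mono-≤ (≤ᵇ⇒≤ a b a≤b) (*-monoʳ-≤ k (evalᶜ-mono-≤ᶜ p q k p≤q))

≤-by-coefficients : ∀ e e′ → T (coeffs e ≤ᶜ coeffs e′) → ∀ k → ⟦ e ⟧ k ≤ ⟦ e′ ⟧ k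
≤-by-coefficients e e′ h k = subst₂ _≤_ (sym (⟦⟧≡evalᶜ-coeffs e k)) (sym (⟦⟧≡evalᶜ-coeffs e′ k))
  (evalᶜ-mono-≤ᶜ (coeffs e) (coeffs e′) k h)

ratio-lower-step : ∀ {a b c α A B p q r s} → .{{NonZero p}} → .{{NonZero α}} →
  α * c ≡ A * b + B * a → q * b ≤ p * a → p * α * r ≤ s * (A * p + B * q) →
  r * b ≤ s * c
ratio-lower-step {a} {b} {c} {α} {A} {B} {p} {q} {r} {s} rec qb≤pa poly =
  *-cancelˡ-≤ (p * α) {{m*n≢0 p α}} (begin
    p * α * (r * b)                ≡⟨ *-assoc (p * α) r b ⟨
    p * α * r * b                  ≤⟨ *-monoˡ-≤ b poly ⟩
    s * (A * p + B * q) * b        ≡⟨ solve (s ∷ A ∷ p ∷ B ∷ q ∷ b ∷ []) ⟩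
    s * (A * p * b + B * (q * b))  ≤⟨ *-monoʳ-≤ s (+-monoʳ-≤ (A * p * b) (*-monoʳ-≤ B qb≤pa)) ⟩
    s * (A * p * b + B * (p * a))  ≡⟨ solve (s ∷ A ∷ p ∷ b ∷ B ∷ a ∷ []) ⟩
    s * p * (A * b + B * a)        ≡⟨ cong (s * p *_) rec ⟨
    s * p * (α * c)                ≡⟨ solve (s ∷ p ∷ α ∷ c ∷ []) ⟩
    p * α * (s * c)                ∎)
  where open ≤-Reasoning

ratio-upper-step : ∀ {a b c α A B p q r s} → .{{NonZero p}} → .{{NonZero α}} →
  α * c ≡ A * b + B * a → p * a ≤ q * b → s * (A * p + B * q) ≤ p * α * r →
  s * c ≤ r * b
ratio-upper-step {a} {b} {c} {α} {A} {B} {p} {q} {r} {s} rec pa≤qb poly =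
  *-cancelˡ-≤ (p * α) {{m*n≢0 p α}} (begin
    p * α * (s * c)                ≡⟨ solve (p ∷ α ∷ s ∷ c ∷ []) ⟩
    s * p * (α * c)                ≡⟨ cong (s * p *_) rec ⟩
    s * p * (A * b + B * a)        ≡⟨ solve (s ∷ p ∷ A ∷ b ∷ B ∷ a ∷ []) ⟩
    s * (A * p * b + B * (p * a))  ≤⟨ *-monoʳ-≤ s (+-monoʳ-≤ (A * p * b) (*-monoʳ-≤ B pa≤qb)) ⟩
    s * (A * p * b + B * (q * b))  ≡⟨ solve (s ∷ A ∷ p ∷ b ∷ B ∷ q ∷ []) ⟩
    s * (A * p + B * q) * b        ≤⟨ *-monoˡ-≤ b poly ⟩
    p * α * r * b                  ≡⟨ *-assoc (p * α) r b ⟩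
    p * α * (r * b)                ∎)
  where open ≤-Reasoning

-- Divided by c⁴ the left side decreases in c / b, so it suffices to know the inequality at c / b = N / D.
quartic-bound : ∀ {b c α A B α′ A′ B′ N D} → .{{NonZero N}} → .{{NonZero D}} →
  N * b ≤ D * c →
  α′ * A * D * (N * N * N) + B * A′ * (D * D * D) * N + B * B′ * D * (D * D * D) ≤ α′ * α * (N * (N * N * N)) →
  B * (b * b * b) * (A′ * c + B′ * b) + α′ * A * (c * c * c) * b ≤ α′ * α * (c * c * c * c)
quartic-bound {b} {c} {α} {A} {B} {α′} {A′} {B′} {N} {D} {{N≢0}} {{D≢0}} Nb≤Dc poly =
  *-cancelˡ-≤ (D * (N * N * N)) {{m*n≢0 D (N * N * N) {{D≢0}} {{m*n≢0 (N * N) N {{m*n≢0 N N}}}}}} (begin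
    D * (N * N * N) * (B * (b * b * b) * (A′ * c + B′ * b) + α′ * A * (c * c * c) * b)
      ≡⟨ solve (D ∷ N ∷ B ∷ b ∷ A′ ∷ c ∷ B′ ∷ α′ ∷ A ∷ []) ⟩
    α′ * A * D * (N * N * N) * (c * c * c * b)
      + B * A′ * D * N * (c * b) * (N * b * (N * b))
      + B * B′ * D * b * (N * b * (N * b) * (N * b))
      ≤⟨ +-mono-≤ (+-monoʳ-≤ (α′ * A * D * (N * N * N) * (c * c * c * b))
                    (*-monoʳ-≤ (B * A′ * D * N * (c * b)) (*-mono-≤ Nb≤Dc Nb≤Dc)))
                  (*-monoʳ-≤ (B * B′ * D * b) (*-mono-≤ (*-mono-≤ Nb≤Dc Nb≤Dc) Nb≤Dc)) ⟩
    α′ * A * D * (N * N * N) * (c * c * c * b)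
      + B * A′ * D * N * (c * b) * (D * c * (D * c))
      + B * B′ * D * b * (D * c * (D * c) * (D * c))
      ≡⟨ solve (α′ ∷ A ∷ D ∷ N ∷ c ∷ b ∷ B ∷ A′ ∷ B′ ∷ []) ⟩
    (α′ * A * D * (N * N * N) + B * A′ * (D * D * D) * N + B * B′ * D * (D * D * D)) * (c * c * c * b)
      ≤⟨ *-monoˡ-≤ (c * c * c * b) poly ⟩
    α′ * α * (N * (N * N * N)) * (c * c * c * b)
      ≡⟨ solve (α′ ∷ α ∷ N ∷ c ∷ b ∷ []) ⟩
    α′ * α * (N * N * N) * (c * c * c) * (N * b)
      ≤⟨ *-monoʳ-≤ (α′ * α * (N * N * N) * (c * c * c)) Nb≤Dc ⟩
    α′ * α * (N * N * N) * (c * c * c) * (D * c)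
      ≡⟨ solve (α′ ∷ α ∷ N ∷ c ∷ D ∷ []) ⟩
    D * (N * N * N) * (α′ * α * (c * c * c * c)) ∎)
  where open ≤-Reasoning

ratio-log-concave-step : ∀ {a b c d α A B α′ A′ B′ N D} →
  .{{NonZero B}} → .{{NonZero α′}} → .{{NonZero N}} → .{{NonZero D}} →
  α * c ≡ A * b + B * a → α′ * d ≡ A′ * c + B′ * b → N * b ≤ D * c →
  α′ * A * D * (N * N * N) + B * A′ * (D * D * D) * N + B * B′ * D * (D * D * D) ≤ α′ * α * (N * (N * N * N)) →
  b ^ 3 * d ≤ c ^ 3 * a
ratio-log-concave-step {a} {b} {c} {d} {α} {A} {B} {α′} {A′} {B′} {N} {D} rec rec′ Nb≤Dc poly =
  *-cancelˡ-≤ (B * α′) {{m*n≢0 B α′}} (+-cancelʳ-≤ (α′ * A * (c * c * c) * b) _ _ (begin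
    -- b * (b * (b * 1)) is b ^ 3 unfolded, which the ring solver needs
    B * α′ * (b * (b * (b * 1)) * d) + α′ * A * (c * c * c) * b
      ≡⟨ solve (B ∷ α′ ∷ b ∷ d ∷ A ∷ c ∷ []) ⟩
    B * (b * b * b) * (α′ * d) + α′ * A * (c * c * c) * b
      ≡⟨ cong (λ x → B * (b * b * b) * x + α′ * A * (c * c * c) * b) rec′ ⟩
    B * (b * b * b) * (A′ * c + B′ * b) + α′ * A * (c * c * c) * b
      ≤⟨ quartic-bound {α = α} {A} {B} {α′} {A′} {B′} {N} {D} Nb≤Dc poly ⟩
    α′ * α * (c * c * c * c)
      ≡⟨ solve (α′ ∷ α ∷ c ∷ []) ⟩
    α′ * (c * c * c) * (α * c)
      ≡⟨ cong (α′ * (c * c * c) *_) rec ⟩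
    α′ * (c * c * c) * (A * b + B * a)
      ≡⟨ solve (α′ ∷ c ∷ A ∷ b ∷ B ∷ a ∷ []) ⟩
    B * α′ * (c * (c * (c * 1)) * a) + α′ * A * (c * c * c) * b ∎))
  where open ≤-Reasoning

^-distribʳ-* : ∀ m n o → (n * o) ^ m ≡ n ^ m * o ^ m
^-distribʳ-* zero    n o = refl
^-distribʳ-* (suc m) n o = trans (cong (n * o *_) (^-distribʳ-* m n o)) (*-interchange n o (n ^ m) (o ^ m))

^-split-cube : ∀ x y k u v → u + v ≡ 3 * k → x ^ u * (x ^ v * y ^ k) ≡ (x ^ 3 * y) ^ k
^-split-cube x y k u v u+v≡3k = begin
  x ^ u * (x ^ v * y ^ k)  ≡⟨ *-assoc (x ^ u) (x ^ v) (y ^ k) ⟨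
  x ^ u * x ^ v * y ^ k    ≡⟨ cong (_* y ^ k) (^-distribˡ-+-* x u v) ⟨
  x ^ (u + v) * y ^ k      ≡⟨ cong (λ e → x ^ e * y ^ k) u+v≡3k ⟩
  x ^ (3 * k) * y ^ k      ≡⟨ cong (_* y ^ k) (^-*-assoc x 3 k) ⟨
  (x ^ 3) ^ k * y ^ k      ≡⟨ ^-distribʳ-* k (x ^ 3) y ⟨
  (x ^ 3 * y) ^ k          ∎
  where open ≡-Reasoning

root-log-concave-step : ∀ {a b c d} k {p q r s} → 0 < c →
  b ^ 3 * d ≤ c ^ 3 * a → a ^ k * c ^ p < b ^ q → q + r ≡ 3 * k → s + p ≡ 3 * k →
  b ^ r * d ^ k < c ^ s
root-log-concave-step {a} {b} {c} {d} k {p} {q} {r} {s} c>0 ratio root q+r≡3k s+p≡3k =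
  *-cancelˡ-< (b ^ q) _ _ (begin-strict
    b ^ q * (b ^ r * d ^ k)  ≡⟨ ^-split-cube b d k q r q+r≡3k ⟩
    (b ^ 3 * d) ^ k          ≤⟨ ^-monoˡ-≤ k ratio ⟩
    (c ^ 3 * a) ^ k          ≡⟨ ^-split-cube c a k s p s+p≡3k ⟨
    c ^ s * (c ^ p * a ^ k)  ≡⟨ cong (c ^ s *_) (*-comm (c ^ p) (a ^ k)) ⟩
    c ^ s * (a ^ k * c ^ p)  <⟨ *-monoʳ-< (c ^ s) {{m^n≢0 c s {{>-nonZero c>0}}}} root ⟩
    c ^ s * b ^ q            ≡⟨ *-comm (c ^ s) (b ^ q) ⟩
    b ^ q * c ^ s            ∎)
  where open ≤-Reasoning

-- The conditions of RatioLogConcaveFrom and RootStrictlyLogConcaveFrom at one index, with n + 1 and n + 2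
-- written 1 + n and 2 + n so that they reduce for n a numeral or a successor.

RatioLogConcaveAt : (ℕ → ℕ) → ℕ → Set
RatioLogConcaveAt a n = a n ^ 3 * a (2 + n) ≤ a (1 + n) ^ 3 * a (n ∸ 1)

RootStrictlyLogConcaveAt : (ℕ → ℕ) → ℕ → Set
RootStrictlyLogConcaveAt a n =
  a (n ∸ 1) ^ (n * (n + 1)) * a (1 + n) ^ ((n ∸ 1) * n) < a n ^ (2 * (n ∸ 1) * (n + 1))

root-log-concave-suc : ∀ a m → 0 < a (2 + m) →
  RatioLogConcaveAt a (1 + m) → RootStrictlyLogConcaveAt a (1 + m) → RootStrictlyLogConcaveAt a (2 + m)
root-log-concave-suc a m a>0 ratio root =
  subst (λ e → a (1 + m) ^ ((2 + m) * (2 + m + 1)) * a (3 + m) ^ e < a (2 + m) ^ (2 * (1 + m) * (2 + m + 1)))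
    (d-exponent m) (root-log-concave-step ((1 + m) * (1 + m + 1))
      {r = (2 + m) * (2 + m + 1)} {s = 2 * (1 + m) * (2 + m + 1)} a>0 ratio root (b-exponents m) (c-exponents m))
  where
  d-exponent : ∀ m → (1 + m) * (1 + m + 1) ≡ (1 + m) * (2 + m)
  d-exponent = solve-∀
  b-exponents : ∀ m → 2 * m * (1 + m + 1) + (2 + m) * (2 + m + 1) ≡ 3 * ((1 + m) * (1 + m + 1))
  b-exponents = solve-∀
  c-exponents : ∀ m → 2 * (1 + m) * (2 + m + 1) + m * (1 + m) ≡ 3 * ((1 + m) * (1 + m + 1))
  c-exponents = solve-∀

from-offset : ∀ {P : ℕ → Set} m → (∀ o → P (m + o)) → ∀ n → m ≤ n → P n
from-offset m h n m≤n with m≤n⇒∃[o]m+o≡n m≤n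
... | o , refl = h o

ratio-log-concave-from : ∀ m a → PositiveFrom m a →
  (∀ n → m + 1 ≤ n → RatioLogConcaveAt a n) → RatioLogConcaveFrom m a
ratio-log-concave-from m a pos lc = pos , λ n h →
  subst₂ (λ u v → a n ^ 3 * a u ≤ a v ^ 3 * a (n ∸ 1)) (+-comm 2 n) (+-comm 1 n) (lc n h)

root-log-concave-from : ∀ m a → PositiveFrom m a →
  (∀ n → m + 1 ≤ n → RootStrictlyLogConcaveAt a n) → RootStrictlyLogConcaveFrom m a
root-log-concave-from m a pos lc = pos , λ n h →
  subst (λ u → a (n ∸ 1) ^ (n * (n + 1)) * a u ^ ((n ∸ 1) * n) < a n ^ (2 * (n ∸ 1) * (n + 1)))
    (+-comm 1 n) (lc n h)

shift : ℕ → Expr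
shift c = con c ⊕ var

cube : Expr → Expr
cube x = x ⊗ x ⊗ x

-- The recurrence of IsFine at index 2 + m, with coefficients as polynomials in m:
-- lead m * f (2 + m) = mid m * f (1 + m) + trail m * f m.
lead mid trail : Expr → Expr
lead  m = con 2 ⊗ (con 3 ⊕ m)
mid   m = con 9 ⊕ con 7 ⊗ m
trail m = con 2 ⊗ (con 3 ⊕ con 2 ⊗ m)

-- At n = 12 + k these are 24n³ − 36n² + 40n − 39, 24n³ − 36n² + 40n − 30 and 6n³, written in k to keep
-- the coefficients natural; lower / denominator and upper / denominator are the bounds on f n / f (n − 1).
-- The constants stand last because a large numeral to the left of _+_ is unfolded one suc at a time when
-- the type checker compares two evaluations of these polynomials.
lower upper denominator : Expr → Expr
lower       k = ((con 24 ⊗ k ⊕ con 828) ⊗ k ⊕ con 9544) ⊗ k ⊕ con 36729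
upper       k = lower k ⊕ con 9
denominator k = con 6 ⊗ cube (con 12 ⊕ k)

⟦⊕con-suc⟧-nonZero : ∀ e c k → NonZero (⟦ e ⊕ con (suc c) ⟧ k)
⟦⊕con-suc⟧-nonZero e c k = >-nonZero (<-≤-trans z<s (m≤n+m (suc c) (⟦ e ⟧ k)))

lower-nonZero : ∀ x k → NonZero (⟦ lower x ⟧ k)
lower-nonZero x k = ⟦⊕con-suc⟧-nonZero (((con 24 ⊗ x ⊕ con 828) ⊗ x ⊕ con 9544) ⊗ x) 36728 k

upper-nonZero : ∀ x k → NonZero (⟦ upper x ⟧ k)
upper-nonZero x k = ⟦⊕con-suc⟧-nonZero (lower x) 8 k

lower-bound-inductive : ∀ k →
  ⟦ upper var ⊗ lead (shift 11) ⊗ lower (shift 1) ⟧ k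
    ≤ ⟦ denominator (shift 1) ⊗ (mid (shift 11) ⊗ upper var ⊕ trail (shift 11) ⊗ denominator var) ⟧ k
lower-bound-inductive = ≤-by-coefficients
  (upper var ⊗ lead (shift 11) ⊗ lower (shift 1))
  (denominator (shift 1) ⊗ (mid (shift 11) ⊗ upper var ⊕ trail (shift 11) ⊗ denominator var)) tt

upper-bound-inductive : ∀ k →
  ⟦ denominator (shift 1) ⊗ (mid (shift 11) ⊗ lower var ⊕ trail (shift 11) ⊗ denominator var) ⟧ k
    ≤ ⟦ lower var ⊗ lead (shift 11) ⊗ upper (shift 1) ⟧ k
upper-bound-inductive = ≤-by-coefficients
  (denominator (shift 1) ⊗ (mid (shift 11) ⊗ lower var ⊕ trail (shift 11) ⊗ denominator var))
  (lower var ⊗ lead (shift 11) ⊗ upper (shift 1)) tt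

lower-bound-quartic : ∀ k →
  let m = shift 11; m′ = shift 12; N = lower (shift 1); D = denominator (shift 1) in
  ⟦ lead m′ ⊗ mid m ⊗ D ⊗ cube N ⊕ trail m ⊗ mid m′ ⊗ cube D ⊗ N
      ⊕ trail m ⊗ trail m′ ⊗ D ⊗ cube D ⟧ k
    ≤ ⟦ lead m′ ⊗ lead m ⊗ (N ⊗ cube N) ⟧ k
lower-bound-quartic =
  let m = shift 11; m′ = shift 12; N = lower (shift 1); D = denominator (shift 1) in
  ≤-by-coefficients
    (lead m′ ⊗ mid m ⊗ D ⊗ cube N ⊕ trail m ⊗ mid m′ ⊗ cube D ⊗ N
      ⊕ trail m ⊗ trail m′ ⊗ D ⊗ cube D)
    (lead m′ ⊗ lead m ⊗ (N ⊗ cube N)) tt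

module FineNumbers (f : ℕ → ℕ) (fine : IsFine f) where

  fine-recurrence : ∀ m → 2 * (3 + m) * f (2 + m) ≡ (9 + 7 * m) * f (1 + m) + 2 * (3 + 2 * m) * f m
  fine-recurrence m = begin
    2 * (3 + m) * f (2 + m)
      ≡⟨ cong (λ x → 2 * x * f (2 + m)) (+-comm 1 (2 + m)) ⟩
    2 * (2 + m + 1) * f (2 + m)
      ≡⟨ proj₂ (proj₂ fine) (2 + m) (s≤s (s≤s z≤n)) ⟩
    (7 * (2 + m) ∸ 5) * f (1 + m) + 2 * (2 * (2 + m) ∸ 1) * f m
      ≡⟨ cong₂ (λ x y → x * f (1 + m) + 2 * y * f m)
           (trans (cong (_∸ 5) (7*[2+m]≡5+[9+7*m] m)) (m+n∸m≡n 5 _))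
           (trans (cong (_∸ 1) (2*[2+m]≡1+[3+2*m] m)) (m+n∸m≡n 1 _)) ⟩
    (9 + 7 * m) * f (1 + m) + 2 * (3 + 2 * m) * f m ∎
    where
    open ≡-Reasoning
    7*[2+m]≡5+[9+7*m] : ∀ m → 7 * (2 + m) ≡ 5 + (9 + 7 * m)
    7*[2+m]≡5+[9+7*m] = solve-∀
    2*[2+m]≡1+[3+2*m] : ∀ m → 2 * (2 + m) ≡ 1 + (3 + 2 * m)
    2*[2+m]≡1+[3+2*m] = solve-∀

  fine-next : ∀ m {x y z} → f m ≡ x → f (1 + m) ≡ y →
    2 * (3 + m) * z ≡ (9 + 7 * m) * y + 2 * (3 + 2 * m) * x → f (2 + m) ≡ z
  fine-next m {x} {y} {z} fm≡x fm+1≡y z-rec = *-cancelˡ-≡ _ _ (2 * (3 + m)) (begin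
    2 * (3 + m) * f (2 + m)
      ≡⟨ fine-recurrence m ⟩
    (9 + 7 * m) * f (1 + m) + 2 * (3 + 2 * m) * f m
      ≡⟨ cong₂ (λ u v → (9 + 7 * m) * u + 2 * (3 + 2 * m) * v) fm+1≡y fm≡x ⟩
    (9 + 7 * m) * y + 2 * (3 + 2 * m) * x
      ≡⟨ z-rec ⟨
    2 * (3 + m) * z ∎)
    where open ≡-Reasoning

  f₂ : f 2 ≡ 1
  f₂ = fine-next 0 (proj₁ fine) (proj₁ (proj₂ fine)) refl
  f₃ : f 3 ≡ 2
  f₃ = fine-next 1 (proj₁ (proj₂ fine)) f₂ refl
  f₄ : f 4 ≡ 6
  f₄ = fine-next 2 f₂ f₃ refl
  f₅ : f 5 ≡ 18
  f₅ = fine-next 3 f₃ f₄ refl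
  f₆ : f 6 ≡ 57
  f₆ = fine-next 4 f₄ f₅ refl
  f₇ : f 7 ≡ 186
  f₇ = fine-next 5 f₅ f₆ refl
  f₈ : f 8 ≡ 622
  f₈ = fine-next 6 f₆ f₇ refl
  f₉ : f 9 ≡ 2120
  f₉ = fine-next 7 f₇ f₈ refl
  f₁₀ : f 10 ≡ 7338
  f₁₀ = fine-next 8 f₈ f₉ refl
  f₁₁ : f 11 ≡ 25724
  f₁₁ = fine-next 9 f₉ f₁₀ refl
  f₁₂ : f 12 ≡ 91144
  f₁₂ = fine-next 10 f₁₀ f₁₁ refl
  f₁₃ : f 13 ≡ 325878
  f₁₃ = fine-next 11 f₁₁ f₁₂ refl

  fine-positive : ∀ m → 0 < f (2 + m)
  fine-positive zero    = subst (0 <_) (sym f₂) z<s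
  fine-positive (suc m) = >-nonZero⁻¹ _ {{m*n≢0⇒n≢0 (2 * (4 + m)) {{>-nonZero lhs>0}}}}
    where
    lhs>0 : 0 < 2 * (4 + m) * f (3 + m)
    lhs>0 = subst (0 <_) (sym (fine-recurrence (1 + m)))
      (<-≤-trans (fine-positive m) (≤-trans (m≤n*m (f (2 + m)) (9 + 7 * (1 + m))) (m≤m+n _ _)))

  ratio-log-concave-by-values : ∀ {n x y z w} →
    f n ≡ x → f (2 + n) ≡ y → f (1 + n) ≡ z → f (n ∸ 1) ≡ w →
    x ^ 3 * y ≤ z ^ 3 * w → RatioLogConcaveAt f n
  ratio-log-concave-by-values refl refl refl refl h = h

  root-log-concave-by-values : ∀ {n x y z} → f (n ∸ 1) ≡ x → f n ≡ y → f (1 + n) ≡ z →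
    x ^ (n * (n + 1)) * z ^ ((n ∸ 1) * n) < y ^ (2 * (n ∸ 1) * (n + 1)) → RootStrictlyLogConcaveAt f n
  root-log-concave-by-values refl refl refl h = h

  fine-ratio-bounds : ∀ k →
    ⟦ lower var ⟧ k * f (11 + k) ≤ ⟦ denominator var ⟧ k * f (12 + k) ×
    ⟦ denominator var ⟧ k * f (12 + k) ≤ ⟦ upper var ⟧ k * f (11 + k)
  fine-ratio-bounds zero =
    subst₂ (λ x y → ⟦ lower var ⟧ 0 * x ≤ ⟦ denominator var ⟧ 0 * y) (sym f₁₁) (sym f₁₂)
      (≤ᵇ⇒≤ _ _ tt) ,
    subst₂ (λ x y → ⟦ denominator var ⟧ 0 * y ≤ ⟦ upper var ⟧ 0 * x) (sym f₁₁) (sym f₁₂)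
      (≤ᵇ⇒≤ _ _ tt)
  fine-ratio-bounds (suc k) =
    ratio-lower-step {f (11 + k)} {f (12 + k)} {f (13 + k)} {⟦ lead m ⟧ k} {⟦ mid m ⟧ k} {⟦ trail m ⟧ k}
      {⟦ upper var ⟧ k} {⟦ denominator var ⟧ k} {⟦ lower (shift 1) ⟧ k} {⟦ denominator (shift 1) ⟧ k}
      {{upper-nonZero var k}} (fine-recurrence (11 + k)) (proj₂ (fine-ratio-bounds k)) (lower-bound-inductive k) ,
    ratio-upper-step {f (11 + k)} {f (12 + k)} {f (13 + k)} {⟦ lead m ⟧ k} {⟦ mid m ⟧ k} {⟦ trail m ⟧ k}
      {⟦ lower var ⟧ k} {⟦ denominator var ⟧ k} {⟦ upper (shift 1) ⟧ k} {⟦ denominator (shift 1) ⟧ k}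
      {{lower-nonZero var k}} (fine-recurrence (11 + k)) (proj₁ (fine-ratio-bounds k)) (upper-bound-inductive k)
    where
    m : Expr
    m = shift 11

  fine-ratio-log-concave-from-12 : ∀ k → RatioLogConcaveAt f (12 + k)
  fine-ratio-log-concave-from-12 k =
    ratio-log-concave-step {f (11 + k)} {f (12 + k)} {f (13 + k)} {f (14 + k)}
      {⟦ lead m ⟧ k} {⟦ mid m ⟧ k} {⟦ trail m ⟧ k} {⟦ lead m′ ⟧ k} {⟦ mid m′ ⟧ k} {⟦ trail m′ ⟧ k}
      {⟦ lower (shift 1) ⟧ k} {⟦ denominator (shift 1) ⟧ k} {{_}} {{_}} {{lower-nonZero (shift 1) k}}
      (fine-recurrence (11 + k)) (fine-recurrence (12 + k)) (proj₁ (fine-ratio-bounds (suc k)))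
      (lower-bound-quartic k)
    where
    m m′ : Expr
    m  = shift 11
    m′ = shift 12

  fine-ratio-log-concave : ∀ o → RatioLogConcaveAt f (6 + o)
  fine-ratio-log-concave 0 = ratio-log-concave-by-values f₆ f₈ f₇ f₅ (≤ᵇ⇒≤ _ _ tt)
  fine-ratio-log-concave 1 = ratio-log-concave-by-values f₇ f₉ f₈ f₆ (≤ᵇ⇒≤ _ _ tt)
  fine-ratio-log-concave 2 = ratio-log-concave-by-values f₈ f₁₀ f₉ f₇ (≤ᵇ⇒≤ _ _ tt)
  fine-ratio-log-concave 3 = ratio-log-concave-by-values f₉ f₁₁ f₁₀ f₈ (≤ᵇ⇒≤ _ _ tt)
  fine-ratio-log-concave 4 = ratio-log-concave-by-values f₁₀ f₁₂ f₁₁ f₉ (≤ᵇ⇒≤ _ _ tt)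
  fine-ratio-log-concave 5 = ratio-log-concave-by-values f₁₁ f₁₃ f₁₂ f₁₀ (≤ᵇ⇒≤ _ _ tt)
  fine-ratio-log-concave (suc (suc (suc (suc (suc (suc k)))))) = fine-ratio-log-concave-from-12 k

  fine-root-log-concave : ∀ o → RootStrictlyLogConcaveAt f (3 + o)
  fine-root-log-concave 0 = root-log-concave-by-values f₂ f₃ f₄ (<ᵇ⇒< _ _ tt)
  fine-root-log-concave 1 = root-log-concave-by-values f₃ f₄ f₅ (<ᵇ⇒< _ _ tt)
  fine-root-log-concave 2 = root-log-concave-by-values f₄ f₅ f₆ (<ᵇ⇒< _ _ tt)
  fine-root-log-concave 3 = root-log-concave-by-values f₅ f₆ f₇ (<ᵇ⇒< _ _ tt)
  fine-root-log-concave (suc (suc (suc (suc o)))) =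
    root-log-concave-suc f (5 + o) (fine-positive (5 + o)) (fine-ratio-log-concave o)
      (fine-root-log-concave (suc (suc (suc o))))

theorem4p4 : (f : ℕ → ℕ) → IsFine f →
    RatioLogConcaveFrom 5 f × RootStrictlyLogConcaveFrom 2 f
theorem4p4 f fine =
  ratio-log-concave-from 5 f (from-offset 5 (λ o → fine-positive (3 + o))) (from-offset 6 fine-ratio-log-concave) ,
  root-log-concave-from 2 f (from-offset 2 fine-positive) (from-offset 3 fine-root-log-concave)
  where open FineNumbers f fine
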